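{- Let $\ell \geq 4$ be an integer, $k = 3\ell+4$, and let $H_k$ be the graph obtained from the square $C_k^2$ of the cycle on $k$ vertices by fixing a vertex $v$ and removing all edges with both endpoints in the neighbourhood of $v$. Then for every positive integer $n \leq \ell/2 - 1$, \[ r(nH_k) \geq (2k-\alpha(H_k))n. \]
   Context: The square $F^2$ of a graph $F$ is obtained by adding an edge between every two vertices at distance at most two in $F$. $nH_k$ is the disjoint union of $n$ copies of $H_k$; $r(F)$ is the least $N$ such that every 2-colouring of the edges of $K_N$ contains a monochromatic copy of $F$; $\alpha$ denotes the independence number. -}

module Defs where

open import Data.Nat using (ℕ; zero; suc; _+_; _*_; _≤_; NonZero)
open import Data.Nat.DivMod using (_%_)
open import Data.Fin using (Fin; toℕ)
open import Data.Bool using (Bool)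
open import Data.List using (List; length)
open import Data.List.Membership.Propositional using (_∈_)
open import Data.List.Relation.Unary.Unique.Propositional using (Unique)
open import Data.Product using (Σ; _×_; _,_)
import Data.Product
open import Data.Sum using (_⊎_)
open import Relation.Nullary using (¬_)
open import Relation.Binary.PropositionalEquality using (_≡_)
open import Function.Definitions using (Injective)

record Graph : Set₁ where
  field
    V   : Set
    Adj : V → V → Set
open Graph public

Cycle : (k : ℕ) → .{{NonZero k}} → Graph
Cycle k = record
  { V   = Fin k
  ; Adj = λ i j → (toℕ j ≡ suc (toℕ i) % k) ⊎ (toℕ i ≡ suc (toℕ j) % k)
  }

Square : Graph → Graph
Square F = record
  { V   = V F
  ; Adj = λ x y → ¬ (x ≡ y) × (Adj F x y ⊎ Σ (V F) λ w → Adj F x w × Adj F w y)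
  }

RemoveNbhdEdges : (G : Graph) → V G → Graph
RemoveNbhdEdges G v = record
  { V   = V G
  ; Adj = λ x y → Adj G x y × ¬ (Adj G v x × Adj G v y)
  }

-- H_k : from C_k² fix a vertex v (vertex 0; C_k² is vertex-transitive)
-- and remove all edges inside N(v).
H : (k : ℕ) → .{{_ : NonZero k}} → Fin k → Graph
H k v = RemoveNbhdEdges (Square (Cycle k)) v

Copies : ℕ → Graph → Graph
Copies n G = record
  { V   = Fin n × V G
  ; Adj = λ p q → (Data.Product.proj₁ p ≡ Data.Product.proj₁ q)
                  × Adj G (Data.Product.proj₂ p) (Data.Product.proj₂ q)
  }

IsIndependentSet : (G : Graph) → List (V G) → Set
IsIndependentSet G xs = Unique xs × (∀ x y → x ∈ xs → y ∈ xs → ¬ Adj G x y)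

IsIndependenceNumber : Graph → ℕ → Set
IsIndependenceNumber G a =
  (Σ (List (V G)) λ xs → IsIndependentSet G xs × length xs ≡ a)
  × (∀ xs → IsIndependentSet G xs → length xs ≤ a)

IsColouring : (N : ℕ) → (Fin N → Fin N → Bool) → Set
IsColouring N c = ∀ i j → c i j ≡ c j i

MonoCopy : (N : ℕ) → (Fin N → Fin N → Bool) → Graph → Set
MonoCopy N c F = Σ Bool λ b → Σ (V F → Fin N) λ f →
  Injective _≡_ _≡_ f × (∀ x y → Adj F x y → c (f x) (f y) ≡ b)

Arrows : ℕ → Graph → Set
Arrows N F = ∀ c → IsColouring N c → MonoCopy N c F

-- r(F) ≥ m  (r(F) is the least N with K_N → F)
RamseyAtLeast : Graph → ℕ → Set
RamseyAtLeast F m = ∀ N → Arrows N F → m ≤ N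

{-# OPTIONS --safe #-}
module Submission where

-- Colour K_N by splitting its vertices into consecutive blocks A, X₁, X₂ of sizes nk − 1,
-- n + 1 and N − nk − n: edges inside A, inside X₁ and between X₁ and X₂ are red, all others
-- blue.  A red nH_k does not fit into A, and red edges never leave A while H_k is connected,
-- so some copy of H_k lies in X₁ ∪ X₂; each of its edges meets X₁ (X₂ is blue inside), so a
-- matching of n + 2 edges of H_k needs n + 2 vertices of X₁.  In a blue copy the A-vertices
-- of each H_k are independent and an X₁-vertex has only A-neighbours, so it lies in no
-- triangle.  Numbering C_k from v = 0, only 0, 1 and k − 1 avoid triangles, and when both
-- 1 and k − 1 are in X₁, trading three A-vertices for the four vertices of N(v) enlarges the
-- independent set.  Thus at most α + 1 vertices of each copy avoid X₂, and counting X₂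
-- gives N ≥ (2k − α)n.

open import Defs
import Data.Nat as ℕ
open import Data.Nat using (ℕ; zero; suc; pred; NonZero; _+_; _*_; _∸_; _≤_; _<_; z≤n; s≤s; _<?_; _≤?_; ⌊_/2⌋)
open import Data.Nat.Properties
open import Data.Nat.Tactic.RingSolver using (solve-∀)
open import Data.Nat.DivMod using (_%_; m<n⇒m%n≡m; n%n≡0)
import Data.Fin as Fin
open import Data.Fin using (Fin; zero; suc; toℕ; fromℕ<; #_)
open import Data.Fin.Properties using (toℕ-injective; toℕ-fromℕ<; toℕ<n)
import Data.Fin.Properties as Finₚ
open import Data.List using (List; []; _∷_; length; map; filter; applyUpTo; cartesianProduct; allFin; _++_)
open import Data.List.Properties using (length-map; length-++; length-applyUpTo; length-removeAt′; length-tabulate; filter-++)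
open import Data.List.Membership.Propositional using (_∈_; _∉_)
open import Data.List.Membership.Propositional.Properties
  using (∈-applyUpTo⁺; ∈-map⁻; ∈-filter⁺; ∈-filter⁻; ∈-++⁻; ∈-++⁺ˡ; ∈-++⁺ʳ; ∈-allFin)
open import Data.List.Membership.DecPropositional ℕ._≟_ using (_∈?_)
open import Data.List.Relation.Unary.Any as Any using (here; there; _─_; any?)
open import Data.List.Relation.Unary.All.Properties using (¬Any⇒All¬; ¬All⇒Any¬)
open import Data.List.Relation.Unary.All as All using (All; all?)
open import Data.List.Relation.Binary.Subset.Propositional using (_⊆_)
open import Data.List.Relation.Unary.Unique.Propositional using (Unique; []; _∷_)
import Data.List.Relation.Unary.Unique.Propositional.Properties as Unique
open import Data.Product using (Σ; ∃; ∃₂; _×_; _,_; proj₁; proj₂)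
open import Data.Sum using (_⊎_; inj₁; inj₂; [_,_])
open import Data.Empty using (⊥; ⊥-elim)
open import Data.Bool using (Bool; true; false)
open import Relation.Nullary using (¬_; yes; no)
open import Relation.Nullary.Decidable using (¬?)
open import Relation.Unary using (Pred; Decidable)
open import Relation.Binary using (DecidableEquality)
open import Relation.Binary.PropositionalEquality hiding ([_]; J)
open import Function using (_∘_)
open import Function.Definitions using (Injective)

-- Counting duplicate-free lists

module _ {A : Set} where

  ∈-─ : ∀ {x y : A} {ys} (x∈ys : x ∈ ys) → y ∈ ys → y ≢ x → y ∈ (ys ─ x∈ys)
  ∈-─ (here refl) (here refl) y≢x = ⊥-elim (y≢x refl)
  ∈-─ (here _)    (there y∈ys) _  = y∈ys
  ∈-─ (there _)   (here refl)  _  = here refl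
  ∈-─ (there x∈ys) (there y∈ys) y≢x = there (∈-─ x∈ys y∈ys y≢x)

  Unique-⊆⇒length-≤ : ∀ {xs ys : List A} → Unique xs → xs ⊆ ys → length xs ≤ length ys
  Unique-⊆⇒length-≤ []                    _  = z≤n
  Unique-⊆⇒length-≤ {x ∷ xs} {ys} (x∉xs ∷ u) xs⊆ys = begin
    suc (length xs)                  ≤⟨ s≤s (Unique-⊆⇒length-≤ u xs⊆ys─x) ⟩
    suc (length (ys ─ x∈ys))         ≡⟨ sym (length-removeAt′ ys (Any.index x∈ys)) ⟩
    length ys                        ∎
    where
    open ≤-Reasoning
    x∈ys = xs⊆ys (here refl)
    xs⊆ys─x : xs ⊆ (ys ─ x∈ys)
    xs⊆ys─x y∈xs = ∈-─ x∈ys (xs⊆ys (there y∈xs)) (λ y≡x → All.lookup x∉xs y∈xs (sym y≡x))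

  length-filter-split : ∀ {p} {P : Pred A p} (P? : Decidable P) (xs : List A) →
    length xs ≡ length (filter P? xs) + length (filter (¬? ∘ P?) xs)
  length-filter-split P? []       = refl
  length-filter-split P? (x ∷ xs) with P? x
  ... | yes _ = cong suc (length-filter-split P? xs)
  ... | no  _ = trans (cong suc (length-filter-split P? xs)) (sym (+-suc _ _))

filter-map : ∀ {A B : Set} {p} {P : Pred B p} (P? : Decidable P) (g : A → B) xs →
  filter P? (map g xs) ≡ map g (filter (P? ∘ g) xs)
filter-map P? g []       = refl
filter-map P? g (x ∷ xs) with P? (g x)
... | yes _ = cong (g x ∷_) (filter-map P? g xs)
... | no  _ = filter-map P? g xs

length-cartesianProduct : ∀ {A B : Set} (xs : List A) (ys : List B) →
  length (cartesianProduct xs ys) ≡ length xs * length ys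
length-cartesianProduct []       ys = refl
length-cartesianProduct (x ∷ xs) ys = begin
  length (map (x ,_) ys ++ cartesianProduct xs ys)
    ≡⟨ length-++ (map (x ,_) ys) ⟩
  length (map (x ,_) ys) + length (cartesianProduct xs ys)
    ≡⟨ cong₂ _+_ (length-map (x ,_) ys) (length-cartesianProduct xs ys) ⟩
  length ys + length xs * length ys
    ∎
  where open ≡-Reasoning

length-allFin : ∀ n → length (allFin n) ≡ n
length-allFin n = length-tabulate (λ i → i)

Unique-interval⇒length-≤ : ∀ {N} {xs : List (Fin N)} lo d → Unique xs →
  (∀ {x} → x ∈ xs → lo ≤ toℕ x × toℕ x < lo + d) → length xs ≤ d
Unique-interval⇒length-≤ {xs = xs} lo d xs-unique xs-in = begin
  length xs                       ≡⟨ length-map toℕ xs ⟨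
  length (map toℕ xs)             ≤⟨ Unique-⊆⇒length-≤ (Unique.map⁺ toℕ-injective xs-unique) toℕxs⊆ ⟩
  length (applyUpTo (lo +_) d)    ≡⟨ length-applyUpTo (lo +_) d ⟩
  d                               ∎
  where
  open ≤-Reasoning
  toℕxs⊆ : map toℕ xs ⊆ applyUpTo (lo +_) d
  toℕxs⊆ i∈ with x , x∈xs , refl ← ∈-map⁻ toℕ i∈ with lo≤x , x<lo+d ← xs-in x∈xs =
    subst (_∈ applyUpTo (lo +_) d) (m+[n∸m]≡n lo≤x)
      (∈-applyUpTo⁺ (lo +_) (subst (toℕ x ∸ lo <_) (m+n∸m≡n lo d) (∸-monoˡ-< x<lo+d lo≤x)))

-- The graph H_k

module HStructure (m : ℕ) where

  k : ℕ
  k = 9 + m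

  -- Adjacency in C_k and in C_k², read off the vertex numbers 0 … 8 + m; the wrap
  -- constructors are the steps through k − 1 → 0.
  data Succ : ℕ → ℕ → Set where
    step : ∀ {i} → Succ i (suc i)
    wrap : Succ (8 + m) 0

  data Ahead : ℕ → ℕ → Set where
    ahead₁ : ∀ {i} → Ahead i (1 + i)
    ahead₂ : ∀ {i} → Ahead i (2 + i)
    wrap₁  : Ahead (8 + m) 0
    wrap₂  : Ahead (8 + m) 1
    wrap₂′ : Ahead (7 + m) 0

  Near : ℕ → ℕ → Set
  Near i j = Ahead i j ⊎ Ahead j i

  data N₀ : ℕ → Set where
    at1   : N₀ 1
    at2   : N₀ 2
    at7+m : N₀ (7 + m)
    at8+m : N₀ (8 + m)

  Ahead-irrefl : ∀ {i} → ¬ Ahead i i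
  Ahead-irrefl ()

  Succ⇒Ahead : ∀ {i j} → Succ i j → Ahead i j
  Succ⇒Ahead step = ahead₁
  Succ⇒Ahead wrap = wrap₁

  Succ-Succ⇒Ahead : ∀ {i j l} → Succ i j → Succ j l → Ahead i l
  Succ-Succ⇒Ahead step step = ahead₂
  Succ-Succ⇒Ahead step wrap = wrap₂′
  Succ-Succ⇒Ahead wrap step = wrap₂

  Succ-injective : ∀ {i j l} → Succ i l → Succ j l → i ≡ j
  Succ-injective step step = refl
  Succ-injective wrap wrap = refl

  Succ-functional : ∀ {i j l} → j < k → l < k → Succ i j → Succ i l → j ≡ l
  Succ-functional _   _   step step = refl
  Succ-functional j<k _   step wrap = ⊥-elim (<-irrefl refl j<k)
  Succ-functional _   l<k wrap step = ⊥-elim (<-irrefl refl l<k)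
  Succ-functional _   _   wrap wrap = refl

  Near0⇒N₀ : ∀ {j} → Near 0 j → N₀ j
  Near0⇒N₀ (inj₁ ahead₁) = at1
  Near0⇒N₀ (inj₁ ahead₂) = at2
  Near0⇒N₀ (inj₂ wrap₁)  = at8+m
  Near0⇒N₀ (inj₂ wrap₂′) = at7+m

  ¬N₀-middle : ∀ {i} → 3 ≤ i → i ≤ 6 + m → ¬ N₀ i
  ¬N₀-middle (s≤s ())        _   at1
  ¬N₀-middle (s≤s (s≤s ()))  _   at2
  ¬N₀-middle _               i≤  at7+m = <-irrefl refl i≤
  ¬N₀-middle _               i≤  at8+m = <-irrefl refl (≤-pred (m≤n⇒m≤1+n i≤))

  ¬N₀-3 : ¬ N₀ 3
  ¬N₀-3 ()

  ¬N₀-6+m : ¬ N₀ (6 + m)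
  ¬N₀-6+m = ¬N₀-middle (m≤m+n 3 (3 + m)) ≤-refl

  C² : Graph
  C² = Square (Cycle k)

  Hk : Graph
  Hk = H k zero

  infix 4 _~_
  _~_ : Fin k → Fin k → Set
  x ~ y = Adj Hk x y

  vertex : (i : ℕ) → .(i < k) → Fin k
  vertex i i<k = fromℕ< i<k

  succ-mod : ∀ {i j} → j < k → Succ i j → j ≡ suc i % k
  succ-mod j<k step = sym (m<n⇒m%n≡m j<k)
  succ-mod _   wrap = sym (n%n≡0 k)

  mod-succ : ∀ {i j} → i < k → j ≡ suc i % k → Succ i j
  mod-succ {i} i<k refl with suc i <? k
  ... | yes 1+i<k = subst (Succ i) (sym (m<n⇒m%n≡m 1+i<k)) step
  ... | no  1+i≮k = subst₂ Succ (suc-injective (sym 1+i≡k)) (sym (trans (cong (_% k) 1+i≡k) (n%n≡0 k))) wrap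
    where 1+i≡k = ≤-antisym i<k (≮⇒≥ 1+i≮k)

  cycle⇒Succ : ∀ {x y} → Adj (Cycle k) x y → Succ (toℕ x) (toℕ y) ⊎ Succ (toℕ y) (toℕ x)
  cycle⇒Succ {x} {y} (inj₁ y≡) = inj₁ (mod-succ (toℕ<n x) y≡)
  cycle⇒Succ {x} {y} (inj₂ x≡) = inj₂ (mod-succ (toℕ<n y) x≡)

  Succ⇒cycle : ∀ {x y i j} → toℕ x ≡ i → toℕ y ≡ j → Succ i j → Adj (Cycle k) x y
  Succ⇒cycle {y = y} refl refl s = inj₁ (succ-mod (toℕ<n y) s)

  square⇒Near : ∀ {x y} → Adj C² x y → Near (toℕ x) (toℕ y)
  square⇒Near (_ , inj₁ xy) with cycle⇒Succ xy
  ... | inj₁ s = inj₁ (Succ⇒Ahead s)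
  ... | inj₂ s = inj₂ (Succ⇒Ahead s)
  square⇒Near {x} {y} (x≢y , inj₂ (_ , xw , wy)) with cycle⇒Succ xw | cycle⇒Succ wy
  ... | inj₁ s | inj₁ s′ = inj₁ (Succ-Succ⇒Ahead s s′)
  ... | inj₂ s | inj₂ s′ = inj₂ (Succ-Succ⇒Ahead s′ s)
  ... | inj₁ s | inj₂ s′ = ⊥-elim (x≢y (toℕ-injective (Succ-injective s s′)))
  ... | inj₂ s | inj₁ s′ = ⊥-elim (x≢y (toℕ-injective (Succ-functional (toℕ<n x) (toℕ<n y) s s′)))

  Ahead⇒square : ∀ {x y i j} → toℕ x ≡ i → toℕ y ≡ j → Ahead i j → Adj C² x y
  Ahead⇒square {x} {y} x≡ y≡ a = x≢y , path x≡ y≡ a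
    where
    x≢y : x ≢ y
    x≢y refl = Ahead-irrefl (subst (Ahead _) (trans (sym y≡) x≡) a)
    path : ∀ {i j} → toℕ x ≡ i → toℕ y ≡ j → Ahead i j →
      Adj (Cycle k) x y ⊎ ∃ λ w → Adj (Cycle k) x w × Adj (Cycle k) w y
    path x≡ y≡ ahead₁ = inj₁ (Succ⇒cycle x≡ y≡ step)
    path x≡ y≡ wrap₁  = inj₁ (Succ⇒cycle x≡ y≡ wrap)
    path {i} x≡ y≡ ahead₂ =
      inj₂ (w , Succ⇒cycle x≡ (toℕ-fromℕ< 1+i<k) step , Succ⇒cycle (toℕ-fromℕ< 1+i<k) y≡ step)
      where
      1+i<k : suc i < k
      1+i<k = ≤-trans (n≤1+n _) (subst (_< k) y≡ (toℕ<n y))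
      w = vertex (suc i) 1+i<k
    path x≡ y≡ wrap₂  = inj₂ (zero , Succ⇒cycle x≡ refl wrap , Succ⇒cycle refl y≡ step)
    path x≡ y≡ wrap₂′ =
      inj₂ (w , Succ⇒cycle x≡ (toℕ-fromℕ< (n<1+n _)) step , Succ⇒cycle (toℕ-fromℕ< (n<1+n _)) y≡ wrap)
      where w = vertex (8 + m) (n<1+n _)

  square-sym : ∀ {x y} → Adj C² x y → Adj C² y x
  square-sym (x≢y , inj₁ xy)            = x≢y ∘ sym , inj₁ (Data.Sum.swap xy)
  square-sym (x≢y , inj₂ (w , xw , wy)) = x≢y ∘ sym , inj₂ (w , Data.Sum.swap wy , Data.Sum.swap xw)

  N₀⇒square-adj-0 : ∀ {x i} → toℕ x ≡ i → N₀ i → Adj C² zero x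
  N₀⇒square-adj-0 x≡ at1   = Ahead⇒square refl x≡ ahead₁
  N₀⇒square-adj-0 x≡ at2   = Ahead⇒square refl x≡ ahead₂
  N₀⇒square-adj-0 x≡ at7+m = square-sym (Ahead⇒square x≡ refl wrap₂′)
  N₀⇒square-adj-0 x≡ at8+m = square-sym (Ahead⇒square x≡ refl wrap₁)

  Ahead⇒~ : ∀ {x y i j} → toℕ x ≡ i → toℕ y ≡ j → Ahead i j → ¬ N₀ i ⊎ ¬ N₀ j → x ~ y
  Ahead⇒~ {x} {y} x≡ y≡ a off = Ahead⇒square x≡ y≡ a , not-both-in-N₀
    where
    not-both-in-N₀ : ¬ (Adj C² zero x × Adj C² zero y)
    not-both-in-N₀ (0x , 0y) =
      [ (λ ¬N₀i → ¬N₀i (subst N₀ x≡ (Near0⇒N₀ (square⇒Near 0x))))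
      , (λ ¬N₀j → ¬N₀j (subst N₀ y≡ (Near0⇒N₀ (square⇒Near 0y)))) ] off

  ~-sym : ∀ {x y} → x ~ y → y ~ x
  ~-sym (xy , not-both) = square-sym xy , not-both ∘ Data.Product.swap

  ~⇒Near : ∀ {x y} → x ~ y → Near (toℕ x) (toℕ y)
  ~⇒Near = square⇒Near ∘ proj₁

  N₀-independent : ∀ {x y} → x ~ y → N₀ (toℕ x) → N₀ (toℕ y) → ⊥
  N₀-independent (_ , not-both) x∈N₀ y∈N₀ =
    not-both (N₀⇒square-adj-0 refl x∈N₀ , N₀⇒square-adj-0 refl y∈N₀)

  inner-Ahead⇒~ : ∀ {x y i j} → toℕ x ≡ i → toℕ y ≡ j → Ahead i j →
    2 ≤ i → i < j → j ≤ 7 + m → x ~ y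
  inner-Ahead⇒~ x≡ y≡ a 2≤i i<j j≤ = Ahead⇒~ x≡ y≡ a (off a 2≤i i<j j≤)
    where
    off : ∀ {i j} → Ahead i j → 2 ≤ i → i < j → j ≤ 7 + m → ¬ N₀ i ⊎ ¬ N₀ j
    off {zero}        _      ()                _   _
    off {suc zero}    _      (s≤s ())          _   _
    off {2}           ahead₁ _                 _   _  = inj₂ (¬N₀-middle ≤-refl (m≤m+n 3 (3 + m)))
    off {2}           ahead₂ _                 _   _  = inj₂ (¬N₀-middle (n≤1+n 3) (m≤m+n 4 (2 + m)))
    off {suc (suc (suc i))} _ _                i<j j≤ =
      inj₁ (¬N₀-middle (s≤s (s≤s (s≤s z≤n))) (≤-pred (≤-trans i<j j≤)))

  v6+m v7+m v8+m : Fin k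
  v6+m = vertex (6 + m) (+-monoˡ-≤ m (m≤m+n 7 2))
  v7+m = vertex (7 + m) (+-monoˡ-≤ m (n≤1+n 8))
  v8+m = vertex (8 + m) ≤-refl

  toℕ-v6+m : toℕ v6+m ≡ 6 + m
  toℕ-v6+m = toℕ-fromℕ< (+-monoˡ-≤ m (m≤m+n 7 2))

  toℕ-v7+m : toℕ v7+m ≡ 7 + m
  toℕ-v7+m = toℕ-fromℕ< (+-monoˡ-≤ m (n≤1+n 8))

  toℕ-v8+m : toℕ v8+m ≡ 8 + m
  toℕ-v8+m = toℕ-fromℕ< ≤-refl

  triangle : ∀ {x y z i} → toℕ x ≡ i → toℕ y ≡ 1 + i → toℕ z ≡ 2 + i → 2 ≤ i → i ≤ 5 + m →
    x ~ y × y ~ z × x ~ z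
  triangle x≡ y≡ z≡ 2≤i i≤ =
      inner-Ahead⇒~ x≡ y≡ ahead₁ 2≤i ≤-refl (s≤s (m≤n⇒m≤1+n i≤))
    , inner-Ahead⇒~ y≡ z≡ ahead₁ (m≤n⇒m≤1+n 2≤i) ≤-refl (s≤s (s≤s i≤))
    , inner-Ahead⇒~ x≡ z≡ ahead₂ 2≤i (n≤1+n _) (s≤s (s≤s i≤))

  InTriangle : Fin k → Set
  InTriangle x = ∃₂ λ y z → x ~ y × x ~ z × y ~ z

  module _ {x y z : Fin k} (xyz : x ~ y × y ~ z × x ~ z) where
    private
      x~y = proj₁ xyz
      y~z = proj₁ (proj₂ xyz)
      x~z = proj₂ (proj₂ xyz)

    corner₁ : InTriangle x
    corner₁ = y , z , x~y , x~z , y~z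

    corner₂ : InTriangle y
    corner₂ = x , z , ~-sym x~y , y~z , x~z

    corner₃ : InTriangle z
    corner₃ = x , y , ~-sym x~z , ~-sym y~z , x~y

  in-triangle : ∀ x → toℕ x ≢ 0 → toℕ x ≢ 1 → toℕ x ≢ 8 + m → InTriangle x
  in-triangle x x≢0 x≢1 x≢8+m = go (toℕ x) refl
    where
    2≤5+m : 2 ≤ 5 + m
    2≤5+m = m≤m+n 2 (3 + m)
    go : ∀ i → toℕ x ≡ i → InTriangle x
    go 0 x≡ = ⊥-elim (x≢0 x≡)
    go 1 x≡ = ⊥-elim (x≢1 x≡)
    go 2 x≡ = corner₁ (triangle {y = # 3} {z = # 4} x≡ refl refl ≤-refl 2≤5+m)
    go 3 x≡ = corner₂ (triangle {x = # 2} {z = # 4} refl x≡ refl ≤-refl 2≤5+m)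
    go (suc (suc (suc (suc i)))) x≡ =
      corner₃ (triangle (toℕ-fromℕ< 2+i<k) (toℕ-fromℕ< 3+i<k) x≡ (m≤m+n 2 i) 2+i≤5+m)
      where
      4+i<k : 4 + i < k
      4+i<k = subst (_< k) x≡ (toℕ<n x)
      2+i≤5+m : 2 + i ≤ 5 + m
      2+i≤5+m = ≤-pred (≤-pred (≤-pred (≤∧≢⇒< (≤-pred 4+i<k) (x≢8+m ∘ trans x≡))))
      3+i<k : 3 + i < k
      3+i<k = ≤-trans (n≤1+n _) 4+i<k
      2+i<k : 2 + i < k
      2+i<k = ≤-trans (n≤1+n _) 3+i<k

  edge-invariant⇒constant : ∀ {B : Set} (g : Fin k → B) → (∀ {x y} → x ~ y → g x ≡ g y) →
    ∀ x → g x ≡ g zero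
  edge-invariant⇒constant g respects x = go (toℕ x) refl
    where
    from-2 : ∀ {y} i → toℕ y ≡ 2 + i → i ≤ 5 + m → g y ≡ g zero
    from-2 zero    y≡ _  = sym (respects (Ahead⇒~ refl y≡ ahead₂ (inj₁ λ ())))
    from-2 (suc i) y≡ i≤ =
      trans (sym (respects (inner-Ahead⇒~ (toℕ-fromℕ< 2+i<k) y≡ ahead₁ (m≤m+n 2 i) ≤-refl (s≤s (s≤s i≤)))))
            (from-2 i (toℕ-fromℕ< 2+i<k) (≤-trans (n≤1+n i) i≤))
      where
      2+i<k : 2 + i < k
      2+i<k = s≤s (s≤s (m≤n⇒m≤1+n (m≤n⇒m≤1+n i≤)))
    go : ∀ i → toℕ x ≡ i → g x ≡ g zero
    go 0 x≡ = cong g (toℕ-injective x≡)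
    go 1 x≡ = sym (respects (Ahead⇒~ refl x≡ ahead₁ (inj₁ λ ())))
    go (suc (suc i)) x≡ with i ≤? 5 + m
    ... | yes i≤ = from-2 i x≡ i≤
    ... | no  i≰ = trans (sym (respects (Ahead⇒~ toℕ-v6+m x≡′ ahead₂ (inj₁ ¬N₀-6+m))))
                         (from-2 (4 + m) toℕ-v6+m (n≤1+n _))
      where
      x≡′ : toℕ x ≡ 8 + m
      x≡′ = trans x≡ (cong (2 +_) (≤-antisym (≤-pred (≤-pred (≤-pred (subst (_< k) x≡ (toℕ<n x)))))
                                              (≰⇒> i≰)))

  0~1 : zero ~ # 1
  0~1 = Ahead⇒~ refl refl ahead₁ (inj₁ λ ())

  0~8+m : zero ~ v8+m
  0~8+m = ~-sym (Ahead⇒~ toℕ-v8+m refl wrap₁ (inj₂ λ ()))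

  1~3 : # 1 ~ # 3
  1~3 = Ahead⇒~ refl refl ahead₂ (inj₂ ¬N₀-3)

  8+m~6+m : v8+m ~ v6+m
  8+m~6+m = ~-sym (Ahead⇒~ toℕ-v6+m toℕ-v8+m ahead₂ (inj₁ ¬N₀-6+m))

  N₀⇒~3⊎~6+m : ∀ {x i} → toℕ x ≡ i → N₀ i → x ~ # 3 ⊎ x ~ v6+m
  N₀⇒~3⊎~6+m x≡ at1   = inj₁ (Ahead⇒~ x≡ refl ahead₂ (inj₂ ¬N₀-3))
  N₀⇒~3⊎~6+m x≡ at2   = inj₁ (Ahead⇒~ x≡ refl ahead₁ (inj₂ ¬N₀-3))
  N₀⇒~3⊎~6+m x≡ at7+m = inj₂ (~-sym (Ahead⇒~ toℕ-v6+m x≡ ahead₁ (inj₁ ¬N₀-6+m)))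
  N₀⇒~3⊎~6+m x≡ at8+m = inj₂ (~-sym (Ahead⇒~ toℕ-v6+m x≡ ahead₂ (inj₁ ¬N₀-6+m)))

  hubs : List ℕ
  hubs = 0 ∷ 3 ∷ 6 + m ∷ []

  Near-N₀-cases : ∀ {i j} → N₀ i → Near i j → j < k → j ∈ hubs ⊎ j ≡ 4 ⊎ j ≡ 5 + m ⊎ N₀ j
  Near-N₀-cases at1   (inj₁ ahead₁) _   = inj₂ (inj₂ (inj₂ at2))
  Near-N₀-cases at1   (inj₁ ahead₂) _   = inj₁ (there (here refl))
  Near-N₀-cases at1   (inj₂ ahead₁) _   = inj₁ (here refl)
  Near-N₀-cases at1   (inj₂ wrap₂)  _   = inj₂ (inj₂ (inj₂ at8+m))
  Near-N₀-cases at2   (inj₁ ahead₁) _   = inj₁ (there (here refl))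
  Near-N₀-cases at2   (inj₁ ahead₂) _   = inj₂ (inj₁ refl)
  Near-N₀-cases at2   (inj₂ ahead₁) _   = inj₂ (inj₂ (inj₂ at1))
  Near-N₀-cases at2   (inj₂ ahead₂) _   = inj₁ (here refl)
  Near-N₀-cases at7+m (inj₁ ahead₁) _   = inj₂ (inj₂ (inj₂ at8+m))
  Near-N₀-cases at7+m (inj₁ ahead₂) j<k = ⊥-elim (<-irrefl refl j<k)
  Near-N₀-cases at7+m (inj₁ wrap₂′) _   = inj₁ (here refl)
  Near-N₀-cases at7+m (inj₂ ahead₁) _   = inj₁ (there (there (here refl)))
  Near-N₀-cases at7+m (inj₂ ahead₂) _   = inj₂ (inj₂ (inj₁ refl))
  Near-N₀-cases at8+m (inj₁ ahead₁) j<k = ⊥-elim (<-irrefl refl j<k)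
  Near-N₀-cases at8+m (inj₁ ahead₂) j<k = ⊥-elim (<-irrefl refl (<-trans (n<1+n _) j<k))
  Near-N₀-cases at8+m (inj₁ wrap₁)  _   = inj₁ (here refl)
  Near-N₀-cases at8+m (inj₁ wrap₂)  _   = inj₂ (inj₂ (inj₂ at1))
  Near-N₀-cases at8+m (inj₂ ahead₁) _   = inj₂ (inj₂ (inj₂ at7+m))
  Near-N₀-cases at8+m (inj₂ ahead₂) _   = inj₁ (there (there (here refl)))

  N₀-neighbour : ∀ {x y} → N₀ (toℕ x) → x ~ y → toℕ y ∈ hubs ⊎ y ~ # 3 ⊎ y ~ v6+m
  N₀-neighbour {y = y} x∈N₀ x~y with Near-N₀-cases x∈N₀ (~⇒Near x~y) (toℕ<n y)
  ... | inj₁ hub                  = inj₁ hub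
  ... | inj₂ (inj₁ y≡4)           = inj₂ (inj₁ (~-sym (Ahead⇒~ refl y≡4 ahead₁ (inj₁ ¬N₀-3))))
  ... | inj₂ (inj₂ (inj₁ y≡5+m))  = inj₂ (inj₂ (Ahead⇒~ y≡5+m toℕ-v6+m ahead₁ (inj₂ ¬N₀-6+m)))
  ... | inj₂ (inj₂ (inj₂ y∈N₀))   = inj₂ (N₀⇒~3⊎~6+m refl y∈N₀)

  N₀-vertices : List (Fin k)
  N₀-vertices = # 1 ∷ # 2 ∷ v7+m ∷ v8+m ∷ []

  toℕ-N₀-vertices : map toℕ N₀-vertices ≡ 1 ∷ 2 ∷ 7 + m ∷ 8 + m ∷ []
  toℕ-N₀-vertices = cong₂ (λ i j → 1 ∷ 2 ∷ i ∷ j ∷ []) toℕ-v7+m toℕ-v8+m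

  N₀-vertices-unique : Unique N₀-vertices
  N₀-vertices-unique = Unique.map⁻ {f = toℕ} (subst Unique (sym toℕ-N₀-vertices)
    (  ((λ ()) All.∷ (λ ()) All.∷ (λ ()) All.∷ All.[])
     ∷ ((λ ()) All.∷ (λ ()) All.∷ All.[])
     ∷ ((λ ()) All.∷ All.[])
     ∷ All.[]
     ∷ []))

  ∈N₀-vertices⇒N₀ : ∀ {x} → x ∈ N₀-vertices → N₀ (toℕ x)
  ∈N₀-vertices⇒N₀ (here refl)                         = at1
  ∈N₀-vertices⇒N₀ (there (here refl))                 = at2
  ∈N₀-vertices⇒N₀ (there (there (here refl)))         = subst N₀ (sym toℕ-v7+m) at7+m
  ∈N₀-vertices⇒N₀ (there (there (there (here refl)))) = subst N₀ (sym toℕ-v8+m) at8+m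

  -- Replace I ∩ {0, 3, 6 + m} by N₀: the other neighbours of N₀ are adjacent to 3 or 6 + m.
  enlarge-independent : ∀ {I} → IsIndependentSet Hk I → # 3 ∈ I → v6+m ∈ I →
    ∃ λ J → IsIndependentSet Hk J × suc (length I) ≤ length J
  enlarge-independent {I} (I-unique , I-indep) 3∈I 6+m∈I = J , (J-unique , J-indep) , I<J
    where
    hub? : Decidable (λ (y : Fin k) → toℕ y ∈ hubs)
    hub? y = toℕ y ∈? hubs
    I′ = filter (¬? ∘ hub?) I
    J  = N₀-vertices ++ I′

    I′⊆I : I′ ⊆ I
    I′⊆I = proj₁ ∘ ∈-filter⁻ (¬? ∘ hub?) {xs = I}

    ∉I : ∀ {y} → y ~ # 3 ⊎ y ~ v6+m → y ∉ I
    ∉I (inj₁ y~3) y∈I = I-indep _ _ y∈I 3∈I y~3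
    ∉I (inj₂ y~6) y∈I = I-indep _ _ y∈I 6+m∈I y~6

    N₀∉I : ∀ {x} → x ∈ N₀-vertices → x ∉ I
    N₀∉I x∈N₀ = ∉I (N₀⇒~3⊎~6+m refl (∈N₀-vertices⇒N₀ x∈N₀))

    N₀≁I′ : ∀ {x y} → x ∈ N₀-vertices → y ∈ I′ → ¬ x ~ y
    N₀≁I′ x∈N₀ y∈I′ x~y with N₀-neighbour (∈N₀-vertices⇒N₀ x∈N₀) x~y
    ... | inj₁ hub   = proj₂ (∈-filter⁻ (¬? ∘ hub?) {xs = I} y∈I′) hub
    ... | inj₂ y~3|6 = ∉I y~3|6 (I′⊆I y∈I′)

    J-unique : Unique J
    J-unique = Unique.++⁺ N₀-vertices-unique (Unique.filter⁺ (¬? ∘ hub?) I-unique)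
      λ (x∈N₀ , x∈I′) → N₀∉I x∈N₀ (I′⊆I x∈I′)

    J-indep : ∀ x y → x ∈ J → y ∈ J → ¬ x ~ y
    J-indep x y x∈J y∈J x~y with ∈-++⁻ N₀-vertices x∈J | ∈-++⁻ N₀-vertices y∈J
    ... | inj₁ x∈N₀ | inj₁ y∈N₀ = N₀-independent x~y (∈N₀-vertices⇒N₀ x∈N₀) (∈N₀-vertices⇒N₀ y∈N₀)
    ... | inj₁ x∈N₀ | inj₂ y∈I′ = N₀≁I′ x∈N₀ y∈I′ x~y
    ... | inj₂ x∈I′ | inj₁ y∈N₀ = N₀≁I′ y∈N₀ x∈I′ (~-sym x~y)
    ... | inj₂ x∈I′ | inj₂ y∈I′ = I-indep x y (I′⊆I x∈I′) (I′⊆I y∈I′) x~y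

    hubs-in-I≤3 : length (filter hub? I) ≤ 3
    hubs-in-I≤3 = begin
      length (filter hub? I)            ≡⟨ length-map toℕ (filter hub? I) ⟨
      length (map toℕ (filter hub? I))  ≤⟨ Unique-⊆⇒length-≤ toℕ-hubs-unique toℕ-hub ⟩
      length hubs                       ∎
      where
      open ≤-Reasoning
      toℕ-hubs-unique = Unique.map⁺ toℕ-injective (Unique.filter⁺ hub? I-unique)
      toℕ-hub : map toℕ (filter hub? I) ⊆ hubs
      toℕ-hub i∈ with y , y∈ , refl ← ∈-map⁻ toℕ i∈ = proj₂ (∈-filter⁻ hub? {xs = I} y∈)

    I<J : suc (length I) ≤ length J
    I<J = s≤s (subst (_≤ 3 + length I′) (sym (length-filter-split hub? I)) (+-monoˡ-≤ (length I′) hubs-in-I≤3))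

  -- The edges {3 + 2j, 4 + 2j} form a matching, and ⌊(x − 3)/2⌋ recovers j from either endpoint.
  edge-cover⇒injection : ∀ {p} (P : Pred (Fin k) p) → (∀ {x y} → x ~ y → P x ⊎ P y) →
    ∀ r → r + r ≤ 5 + m → Σ (Fin r → Fin k) λ e → Injective _≡_ _≡_ e × (∀ i → P (e i))
  edge-cover⇒injection P cover r 2r≤5+m = proj₁ ∘ endpoint , e-injective , proj₁ ∘ proj₂ ∘ endpoint
    where
    endpoint : (i : Fin r) → Σ (Fin k) λ x → P x × ⌊ toℕ x ∸ 3 /2⌋ ≡ toℕ i
    endpoint i = choose (cover (inner-Ahead⇒~ x≡ y≡ ahead₁ (s≤s (s≤s z≤n)) ≤-refl 4+2j≤7+m))
      where
      j = toℕ i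
      4+2j≤7+m : 4 + (j + j) ≤ 7 + m
      4+2j≤7+m = s≤s (s≤s (subst (_≤ 5 + m) (cong suc (+-suc j j))
                               (≤-trans (+-mono-≤ (toℕ<n i) (toℕ<n i)) 2r≤5+m)))
      4+2j<k : 4 + (j + j) < k
      4+2j<k = s≤s (m≤n⇒m≤1+n 4+2j≤7+m)
      3+2j<k : 3 + (j + j) < k
      3+2j<k = ≤-trans (n≤1+n _) 4+2j<k
      x = vertex (3 + (j + j)) 3+2j<k
      y = vertex (4 + (j + j)) 4+2j<k
      x≡ : toℕ x ≡ 3 + (j + j)
      x≡ = toℕ-fromℕ< 3+2j<k
      y≡ : toℕ y ≡ 4 + (j + j)
      y≡ = toℕ-fromℕ< 4+2j<k
      choose : P x ⊎ P y → Σ (Fin k) λ z → P z × ⌊ toℕ z ∸ 3 /2⌋ ≡ j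
      choose (inj₁ Px) = x , Px , trans (cong (λ t → ⌊ t ∸ 3 /2⌋) x≡) (sym (n≡⌊n+n/2⌋ j))
      choose (inj₂ Py) = y , Py , trans (cong (λ t → ⌊ t ∸ 3 /2⌋) y≡) (sym (n≡⌈n+n/2⌉ j))

    e-injective : Injective _≡_ _≡_ (proj₁ ∘ endpoint)
    e-injective {i} {j} ei≡ej = toℕ-injective (begin
      toℕ i                                       ≡⟨ proj₂ (proj₂ (endpoint i)) ⟨
      ⌊ toℕ (proj₁ (endpoint i)) ∸ 3 /2⌋          ≡⟨ cong (λ x → ⌊ toℕ x ∸ 3 /2⌋) ei≡ej ⟩
      ⌊ toℕ (proj₁ (endpoint j)) ∸ 3 /2⌋          ≡⟨ proj₂ (proj₂ (endpoint j)) ⟩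
      toℕ j                                       ∎)
      where open ≡-Reasoning

  independent⇒2+length≤k : ∀ {I} → IsIndependentSet Hk I → 2 + length I ≤ k
  independent⇒2+length≤k {I} (I-unique , I-indep) = begin
    2 + length I     ≤⟨ Unique-⊆⇒length-≤ e₀e₁I-unique (λ {x} _ → ∈-allFin x) ⟩
    length (allFin k) ≡⟨ length-allFin k ⟩
    k                ∎
    where
    open ≤-Reasoning
    misses : ∀ {x y} → x ~ y → x ∉ I ⊎ y ∉ I
    misses {x} {y} x~y with any? (x Fin.≟_) I
    ... | no  x∉I = inj₁ x∉I
    ... | yes x∈I = inj₂ λ y∈I → I-indep x y x∈I y∈I x~y
    cover = edge-cover⇒injection (_∉ I) misses 2 (m≤m+n 4 (1 + m))
    e = proj₁ cover
    e∉I = proj₂ (proj₂ cover)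
    e₀e₁I-unique : Unique (e zero ∷ e (suc zero) ∷ I)
    e₀e₁I-unique = ((Finₚ.0≢1+n ∘ proj₁ (proj₂ cover)) All.∷ ¬Any⇒All¬ I (e∉I zero))
                 ∷ ¬Any⇒All¬ I (e∉I (suc zero)) ∷ I-unique

-- The colouring

data Part : Set where
  A X₁ X₂ : Part

_≟ₚ_ : DecidableEquality Part
A  ≟ₚ A  = yes refl
A  ≟ₚ X₁ = no λ ()
A  ≟ₚ X₂ = no λ ()
X₁ ≟ₚ A  = no λ ()
X₁ ≟ₚ X₁ = yes refl
X₁ ≟ₚ X₂ = no λ ()
X₂ ≟ₚ A  = no λ ()
X₂ ≟ₚ X₁ = no λ ()
X₂ ≟ₚ X₂ = yes refl

pattern red  = true
pattern blue = false

colour : Part → Part → Bool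
colour A  A  = red
colour A  _  = blue
colour _  A  = blue
colour X₂ X₂ = blue
colour _  _  = red

colour-sym : ∀ p q → colour p q ≡ colour q p
colour-sym A  A  = refl
colour-sym A  X₁ = refl
colour-sym A  X₂ = refl
colour-sym X₁ A  = refl
colour-sym X₁ X₁ = refl
colour-sym X₁ X₂ = refl
colour-sym X₂ A  = refl
colour-sym X₂ X₁ = refl
colour-sym X₂ X₂ = refl

isA : Part → Bool
isA A = true
isA _ = false

≢A⇒isA≡false : ∀ {p} → p ≢ A → isA p ≡ false
≢A⇒isA≡false {A}  p≢A = ⊥-elim (p≢A refl)
≢A⇒isA≡false {X₁} _   = refl
≢A⇒isA≡false {X₂} _   = refl

red⇒same-isA : ∀ p q → colour p q ≡ red → isA p ≡ isA q
red⇒same-isA A  A  _ = refl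
red⇒same-isA X₁ X₁ _ = refl
red⇒same-isA X₁ X₂ _ = refl
red⇒same-isA X₂ X₁ _ = refl

red⇒X₁ : ∀ p q → colour p q ≡ red → isA p ≡ false → p ≡ X₁ ⊎ q ≡ X₁
red⇒X₁ X₁ _  _ _ = inj₁ refl
red⇒X₁ X₂ X₁ _ _ = inj₂ refl

X₁≢A : X₁ ≢ A
X₁≢A ()

blue⇒not-both-A : colour A A ≢ blue
blue⇒not-both-A ()

blue-X₁⇒A : ∀ q → colour X₁ q ≡ blue → q ≡ A
blue-X₁⇒A A _ = refl

module CopyColourings (m : ℕ) where
  open HStructure m

  red-copy⇒X₁-injection : (s : Fin k → Part) → (∀ {x y} → x ~ y → colour (s x) (s y) ≡ red) →
    ∀ x → s x ≢ A → ∀ r → r + r ≤ 5 + m →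
    Σ (Fin r → Fin k) λ e → Injective _≡_ _≡_ e × (∀ i → s (e i) ≡ X₁)
  red-copy⇒X₁-injection s red-edges x sx≢A = edge-cover⇒injection (λ y → s y ≡ X₁) red-edge-meets-X₁
    where
    isA-constant : ∀ y → isA (s y) ≡ isA (s zero)
    isA-constant = edge-invariant⇒constant (isA ∘ s) λ {y} {z} y~z → red⇒same-isA (s y) (s z) (red-edges y~z)
    not-A : ∀ y → isA (s y) ≡ false
    not-A y = trans (isA-constant y) (trans (sym (isA-constant x)) (≢A⇒isA≡false sx≢A))
    red-edge-meets-X₁ : ∀ {y z} → y ~ z → s y ≡ X₁ ⊎ s z ≡ X₁
    red-edge-meets-X₁ {y} {z} y~z = red⇒X₁ (s y) (s z) (red-edges y~z) (not-A y)

  module BlueCopy (s : Fin k → Part) (blue-edges : ∀ {x y} → x ~ y → colour (s x) (s y) ≡ blue) where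

    A-vertices : List (Fin k)
    A-vertices = filter (λ x → s x ≟ₚ A) (allFin k)

    A≁A : ∀ {x y} → x ~ y → s x ≡ A → s y ≡ A → ⊥
    A≁A x~y sx≡A sy≡A = blue⇒not-both-A (subst₂ (λ p q → colour p q ≡ blue) sx≡A sy≡A (blue-edges x~y))

    A-vertices-independent : IsIndependentSet Hk A-vertices
    A-vertices-independent = Unique.filter⁺ (λ x → s x ≟ₚ A) (Unique.allFin⁺ k) ,
      λ x y x∈ y∈ x~y → A≁A x~y (is-A x∈) (is-A y∈)
      where
      is-A : ∀ {x} → x ∈ A-vertices → s x ≡ A
      is-A = proj₂ ∘ ∈-filter⁻ (λ x → s x ≟ₚ A) {xs = allFin k}

    ∈A-vertices : ∀ {x} → s x ≡ A → x ∈ A-vertices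
    ∈A-vertices {x} sx≡A = ∈-filter⁺ (λ x → s x ≟ₚ A) (∈-allFin x) sx≡A

    X₁-neighbour : ∀ {x y} → s x ≡ X₁ → x ~ y → s y ≡ A
    X₁-neighbour {y = y} sx≡X₁ x~y =
      blue-X₁⇒A (s y) (subst (λ p → colour p (s y) ≡ blue) sx≡X₁ (blue-edges x~y))

    X₁≁X₁ : ∀ {x y} → x ~ y → s x ≡ X₁ → s y ≡ X₁ → ⊥
    X₁≁X₁ x~y sx≡X₁ sy≡X₁ = X₁≢A (trans (sym sy≡X₁) (X₁-neighbour sx≡X₁ x~y))

    X₁-vertex : ∀ {x} → s x ≡ X₁ → x ≡ zero ⊎ x ≡ # 1 ⊎ x ≡ v8+m
    X₁-vertex {x} sx≡X₁ with toℕ x ℕ.≟ 0 | toℕ x ℕ.≟ 1 | toℕ x ℕ.≟ 8 + m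
    ... | yes x≡0 | _       | _         = inj₁ (toℕ-injective x≡0)
    ... | no _    | yes x≡1 | _         = inj₂ (inj₁ (toℕ-injective x≡1))
    ... | no _    | no _    | yes x≡8+m = inj₂ (inj₂ (toℕ-injective (trans x≡8+m (sym toℕ-v8+m))))
    ... | no x≢0  | no x≢1  | no x≢8+m
        with y , z , x~y , x~z , y~z ← in-triangle x x≢0 x≢1 x≢8+m =
      ⊥-elim (A≁A y~z (X₁-neighbour sx≡X₁ x~y) (X₁-neighbour sx≡X₁ x~z))

    non-X₂ : List (Fin k)
    non-X₂ = filter (λ x → ¬? (s x ≟ₚ X₂)) (allFin k)

    non-X₂-unique : Unique non-X₂
    non-X₂-unique = Unique.filter⁺ (λ x → ¬? (s x ≟ₚ X₂)) (Unique.allFin⁺ k)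

    non-X₂-length : ∀ E → (∀ {x} → s x ≡ X₁ → x ∈ E) → length non-X₂ ≤ length E + length A-vertices
    non-X₂-length E X₁⊆E = begin
      length non-X₂               ≤⟨ Unique-⊆⇒length-≤ non-X₂-unique non-X₂⊆ ⟩
      length (E ++ A-vertices)    ≡⟨ length-++ E ⟩
      length E + length A-vertices ∎
      where
      open ≤-Reasoning
      non-X₂⊆ : non-X₂ ⊆ E ++ A-vertices
      non-X₂⊆ {x} x∈ with s x in sx | proj₂ (∈-filter⁻ (λ x → ¬? (s x ≟ₚ X₂)) {xs = allFin k} x∈)
      ... | A  | _     = ∈-++⁺ʳ E (∈A-vertices sx)
      ... | X₁ | _     = ∈-++⁺ˡ (X₁⊆E sx)
      ... | X₂ | sx≢X₂ = ⊥-elim (sx≢X₂ refl)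

    X₁⊆ : ∀ {E} → (s zero ≡ X₁ → zero ∈ E) → (s (# 1) ≡ X₁ → # 1 ∈ E) →
      (s v8+m ≡ X₁ → v8+m ∈ E) → ∀ {x} → s x ≡ X₁ → x ∈ E
    X₁⊆ at-0 at-1 at-8+m sx≡X₁ with X₁-vertex sx≡X₁
    ... | inj₁ refl        = at-0 sx≡X₁
    ... | inj₂ (inj₁ refl) = at-1 sx≡X₁
    ... | inj₂ (inj₂ refl) = at-8+m sx≡X₁

    module _ {a} (α-bound : ∀ I → IsIndependentSet Hk I → length I ≤ a) where

      |A|≤a : length A-vertices ≤ a
      |A|≤a = α-bound A-vertices A-vertices-independent

      |A|<a : s (# 1) ≡ X₁ → s v8+m ≡ X₁ → suc (length A-vertices) ≤ a
      |A|<a s1 s8 with J , J-indep , |A|<|J| ← enlarge-independent A-vertices-independent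
                         (∈A-vertices (X₁-neighbour s1 1~3)) (∈A-vertices (X₁-neighbour s8 8+m~6+m)) =
        ≤-trans |A|<|J| (α-bound J J-indep)

      non-X₂-bound : length non-X₂ ≤ suc a
      non-X₂-bound with s zero ≟ₚ X₁ | s (# 1) ≟ₚ X₁ | s v8+m ≟ₚ X₁
      ... | yes s0 | _      | _      = ≤-trans (non-X₂-length (zero ∷ [])
            (X₁⊆ (λ _ → here refl) (⊥-elim ∘ X₁≁X₁ 0~1 s0) (⊥-elim ∘ X₁≁X₁ 0~8+m s0))) (s≤s |A|≤a)
      ... | no s0  | yes s1 | yes s8 = ≤-trans (non-X₂-length (# 1 ∷ v8+m ∷ [])
            (X₁⊆ (⊥-elim ∘ s0) (λ _ → here refl) (λ _ → there (here refl)))) (s≤s (|A|<a s1 s8))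
      ... | no s0  | no s1  | _      = ≤-trans (non-X₂-length (v8+m ∷ [])
            (X₁⊆ (⊥-elim ∘ s0) (⊥-elim ∘ s1) (λ _ → here refl))) (s≤s |A|≤a)
      ... | no s0  | yes _  | no s8  = ≤-trans (non-X₂-length (# 1 ∷ [])
            (X₁⊆ (⊥-elim ∘ s0) (λ _ → here refl) (⊥-elim ∘ s8))) (s≤s |A|≤a)

module Colouring (N a₀ x₁ : ℕ) where

  part : Fin N → Part
  part i with toℕ i <? a₀ | toℕ i <? a₀ + x₁
  ... | yes _ | _     = A
  ... | no  _ | yes _ = X₁
  ... | no  _ | no  _ = X₂

  block : Part → ℕ × ℕ
  block A  = 0 , a₀
  block X₁ = a₀ , x₁
  block X₂ = a₀ + x₁ , N ∸ (a₀ + x₁)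

  InBlock : Part → ℕ → Set
  InBlock p i = proj₁ (block p) ≤ i × i < proj₁ (block p) + proj₂ (block p)

  part-InBlock : ∀ i → InBlock (part i) (toℕ i)
  part-InBlock i with toℕ i <? a₀ | toℕ i <? a₀ + x₁
  ... | yes i<a₀ | _      = z≤n , i<a₀
  ... | no  i≮a₀ | yes i< = ≮⇒≥ i≮a₀ , i<
  ... | no  _    | no  i≮ =
    ≮⇒≥ i≮ , subst (toℕ i <_) (sym (m+[n∸m]≡n (≤-trans (≮⇒≥ i≮) (<⇒≤ (toℕ<n i))))) (toℕ<n i)

  length-≤-block : ∀ {p} {xs : List (Fin N)} → Unique xs → (∀ {i} → i ∈ xs → part i ≡ p) →
    length xs ≤ proj₂ (block p)
  length-≤-block {p} xs-unique xs⊆p = Unique-interval⇒length-≤ _ _ xs-unique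
    λ {i} i∈xs → subst (λ q → InBlock q (toℕ i)) (xs⊆p i∈xs) (part-InBlock i)

  c : Fin N → Fin N → Bool
  c i j = colour (part i) (part j)

  c-sym : IsColouring N c
  c-sym i j = colour-sym (part i) (part j)

  module _ (m n : ℕ) where
    open HStructure m
    open CopyColourings m

    copy-vertices : List (Fin n × Fin k)
    copy-vertices = cartesianProduct (allFin n) (allFin k)

    copy-vertices-unique : Unique copy-vertices
    copy-vertices-unique = Unique.cartesianProduct⁺ (Unique.allFin⁺ n) (Unique.allFin⁺ k)

    length-copy-vertices : length copy-vertices ≡ n * k
    length-copy-vertices =
      trans (length-cartesianProduct (allFin n) (allFin k)) (cong₂ _*_ (length-allFin n) (length-allFin k))

    no-red-copy : a₀ < n * k → x₁ < 2 + n → (2 + n) + (2 + n) ≤ 5 + m →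
      (f : Fin n × Fin k → Fin N) → Injective _≡_ _≡_ f →
      ¬ (∀ x y → Adj (Copies n Hk) x y → c (f x) (f y) ≡ red)
    no-red-copy a₀<nk x₁<2+n matching-fits f f-inj red-edges with all? (λ q → part (f q) ≟ₚ A) copy-vertices
    ... | yes all-A = <⇒≱ a₀<nk (begin
      n * k                          ≡⟨ length-copy-vertices ⟨
      length copy-vertices           ≡⟨ length-map f copy-vertices ⟨
      length (map f copy-vertices)   ≤⟨ length-≤-block (Unique.map⁺ f-inj copy-vertices-unique) in-A ⟩
      a₀                             ∎)
      where
      open ≤-Reasoning
      in-A : ∀ {i} → i ∈ map f copy-vertices → part i ≡ A
      in-A i∈ with q , q∈ , refl ← ∈-map⁻ f i∈ = All.lookup all-A q∈
    ... | no ¬all-A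
        with (p , j) , pj≢A ← Any.satisfied (¬All⇒Any¬ (λ q → part (f q) ≟ₚ A) copy-vertices ¬all-A) =
      <⇒≱ x₁<2+n (begin
        2 + n                          ≡⟨ length-allFin (2 + n) ⟨
        length (allFin (2 + n))        ≡⟨ length-map g (allFin (2 + n)) ⟨
        length (map g (allFin (2 + n))) ≤⟨ length-≤-block (Unique.map⁺ g-inj (Unique.allFin⁺ (2 + n))) in-X₁ ⟩
        x₁                             ∎)
      where
      open ≤-Reasoning
      s : Fin k → Part
      s x = part (f (p , x))
      matching = red-copy⇒X₁-injection s (λ x~y → red-edges _ _ (refl , x~y)) j pj≢A (2 + n) matching-fits
      g : Fin (2 + n) → Fin N
      g i = f (p , proj₁ matching i)
      g-inj : Injective _≡_ _≡_ g
      g-inj = proj₁ (proj₂ matching) ∘ cong proj₂ ∘ f-inj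
      in-X₁ : ∀ {i} → i ∈ map g (allFin (2 + n)) → part i ≡ X₁
      in-X₁ i∈ with r , _ , refl ← ∈-map⁻ g i∈ = proj₂ (proj₂ matching) r

    blue-copy-bound : ∀ {a} → (∀ I → IsIndependentSet Hk I → length I ≤ a) →
      (f : Fin n × Fin k → Fin N) → Injective _≡_ _≡_ f →
      (∀ x y → Adj (Copies n Hk) x y → c (f x) (f y) ≡ blue) →
      n * k ≤ (N ∸ (a₀ + x₁)) + n * suc a
    blue-copy-bound {a} α-bound f f-inj blue-edges = begin
      n * k                                                     ≡⟨ length-copy-vertices ⟨
      length copy-vertices                                      ≡⟨ length-filter-split X₂? copy-vertices ⟩
      length (filter X₂? copy-vertices) + length (filter (¬? ∘ X₂?) copy-vertices)
                                                                ≤⟨ +-mono-≤ X₂-bound (non-X₂-in-copies (allFin n)) ⟩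
      (N ∸ (a₀ + x₁)) + length (allFin n) * suc a               ≡⟨ cong (λ t → _ + t * suc a) (length-allFin n) ⟩
      (N ∸ (a₀ + x₁)) + n * suc a                               ∎
      where
      open ≤-Reasoning
      X₂? : Decidable (λ q → part (f q) ≡ X₂)
      X₂? q = part (f q) ≟ₚ X₂

      X₂-bound : length (filter X₂? copy-vertices) ≤ N ∸ (a₀ + x₁)
      X₂-bound = begin
        length (filter X₂? copy-vertices)         ≡⟨ length-map f (filter X₂? copy-vertices) ⟨
        length (map f (filter X₂? copy-vertices)) ≤⟨ length-≤-block X₂-images-unique in-X₂ ⟩
        N ∸ (a₀ + x₁)                             ∎
        where
        X₂-images-unique = Unique.map⁺ f-inj (Unique.filter⁺ X₂? copy-vertices-unique)
        in-X₂ : ∀ {i} → i ∈ map f (filter X₂? copy-vertices) → part i ≡ X₂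
        in-X₂ i∈ with q , q∈ , refl ← ∈-map⁻ f i∈ = proj₂ (∈-filter⁻ X₂? {xs = copy-vertices} q∈)

      non-X₂-in-copy : ∀ p → length (filter (¬? ∘ X₂?) (map (p ,_) (allFin k))) ≤ suc a
      non-X₂-in-copy p = begin
        length (filter (¬? ∘ X₂?) (map (p ,_) (allFin k)))  ≡⟨ cong length (filter-map (¬? ∘ X₂?) (p ,_) (allFin k)) ⟩
        length (map (p ,_) (BlueCopy.non-X₂ s blue-s))       ≡⟨ length-map (p ,_) (BlueCopy.non-X₂ s blue-s) ⟩
        length (BlueCopy.non-X₂ s blue-s)                    ≤⟨ BlueCopy.non-X₂-bound s blue-s α-bound ⟩
        suc a                                                ∎
        where
        s : Fin k → Part
        s x = part (f (p , x))
        blue-s : ∀ {x y} → x ~ y → colour (s x) (s y) ≡ blue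
        blue-s x~y = blue-edges _ _ (refl , x~y)

      non-X₂-in-copies : ∀ ps → length (filter (¬? ∘ X₂?) (cartesianProduct ps (allFin k))) ≤ length ps * suc a
      non-X₂-in-copies []       = z≤n
      non-X₂-in-copies (p ∷ ps) = begin
        length (filter (¬? ∘ X₂?) (map (p ,_) (allFin k) ++ cartesianProduct ps (allFin k)))
          ≡⟨ cong length (filter-++ (¬? ∘ X₂?) (map (p ,_) (allFin k)) (cartesianProduct ps (allFin k))) ⟩
        length (filter (¬? ∘ X₂?) (map (p ,_) (allFin k)) ++ filter (¬? ∘ X₂?) (cartesianProduct ps (allFin k)))
          ≡⟨ length-++ (filter (¬? ∘ X₂?) (map (p ,_) (allFin k))) ⟩
        length (filter (¬? ∘ X₂?) (map (p ,_) (allFin k))) + length (filter (¬? ∘ X₂?) (cartesianProduct ps (allFin k)))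
          ≤⟨ +-mono-≤ (non-X₂-in-copy p) (non-X₂-in-copies ps) ⟩
        suc a + length ps * suc a ∎

blue-bound⇒lower-bound : ∀ {k n a N s} .{{_ : NonZero n}} → 2 + a ≤ k → s ≡ n * k + n →
  n * k ≤ (N ∸ s) + n * suc a → (2 * k ∸ a) * n ≤ N
blue-bound⇒lower-bound {k} {n} {a} {N} {s} 2+a≤k s≡ blue-bound = +-cancelʳ-≤ (n * suc a) _ _ (begin
  (2 * k ∸ a) * n + n * suc a   ≡⟨ regroup (2 * k ∸ a) a n ⟩
  ((2 * k ∸ a) + a) * n + n     ≡⟨ cong (λ t → t * n + n) (m∸n+n≡m a≤2k) ⟩
  2 * k * n + n                 ≡⟨ double k n ⟩
  n * k + (n * k + n)           ≡⟨ cong (n * k +_) s≡ ⟨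
  n * k + s                     ≤⟨ +-monoˡ-≤ s blue-bound ⟩
  (N ∸ s) + n * suc a + s       ≡⟨ +-assoc (N ∸ s) (n * suc a) s ⟩
  (N ∸ s) + (n * suc a + s)     ≡⟨ cong ((N ∸ s) +_) (+-comm (n * suc a) s) ⟩
  (N ∸ s) + (s + n * suc a)     ≡⟨ +-assoc (N ∸ s) s (n * suc a) ⟨
  (N ∸ s) + s + n * suc a       ≡⟨ cong (_+ n * suc a) (m∸n+n≡m (<⇒≤ s<N)) ⟩
  N + n * suc a                 ∎)
  where
  open ≤-Reasoning
  regroup : ∀ t a n → t * n + n * suc a ≡ (t + a) * n + n
  regroup = solve-∀
  double : ∀ k n → 2 * k * n + n ≡ n * k + (n * k + n)
  double = solve-∀
  a≤2k : a ≤ 2 * k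
  a≤2k = ≤-trans (m≤n+m a 2) (≤-trans 2+a≤k (m≤m+n k (k + 0)))
  s<N : s < N
  s<N = m∸n≢0⇒n<m λ N∸s≡0 →
    <⇒≱ (*-monoʳ-< n 2+a≤k) (subst (λ t → n * k ≤ t + n * suc a) N∸s≡0 blue-bound)

module _ (m : ℕ) where
  open HStructure m

  ramsey-lower-bound : ∀ n a → (3 + n) + (3 + n) ≤ 5 + m → IsIndependenceNumber Hk a →
    RamseyAtLeast (Copies (suc n) Hk) ((2 * k ∸ a) * suc n)
  ramsey-lower-bound n a fits ((I , I-indep , |I|≡a) , α-bound) N arrows = from-mono-copy (arrows c c-sym)
    where
    open Colouring N (pred (suc n * k)) (2 + n)
    from-mono-copy : MonoCopy N c (Copies (suc n) Hk) → (2 * k ∸ a) * suc n ≤ N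
    from-mono-copy (red  , f , f-inj , red-edges)  = ⊥-elim (no-red-copy m (suc n) ≤-refl ≤-refl fits f f-inj red-edges)
    from-mono-copy (blue , f , f-inj , blue-edges) =
      blue-bound⇒lower-bound (subst (λ t → 2 + t ≤ k) |I|≡a (independent⇒2+length≤k I-indep))
        (+-suc (pred (suc n * k)) (suc n)) (blue-copy-bound m (suc n) α-bound f f-inj blue-edges)

proposition5p5 : (ℓ : ℕ) → 4 ≤ ℓ →
    (n : ℕ) → 1 ≤ n → 2 * n + 2 ≤ ℓ →
    (a : ℕ) → IsIndependenceNumber (H (4 + 3 * ℓ) zero) a →
    RamseyAtLeast (Copies n (H (4 + 3 * ℓ) zero)) ((2 * (4 + 3 * ℓ) ∸ a) * n)
-- For ℓ = 4 + ℓ′ we have k = 4 + 3ℓ = 9 + (7 + 3ℓ′).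
proposition5p5 _ (s≤s (s≤s (s≤s (s≤s {n = ℓ′} _)))) (suc n) _ 2n+2≤4+ℓ′ a =
  subst (λ K → IsIndependenceNumber (H (suc K) zero) a →
               RamseyAtLeast (Copies (suc n) (H (suc K) zero)) ((2 * suc K ∸ a) * suc n))
        (cong (3 +_) (sym (*-distribˡ-+ 3 4 ℓ′)))
        (ramsey-lower-bound (7 + 3 * ℓ′) n a fits)
  where
  open ≤-Reasoning
  double : ∀ n → (3 + n) + (3 + n) ≡ 2 + (2 * suc n + 2)
  double = solve-∀
  fits : (3 + n) + (3 + n) ≤ 5 + (7 + 3 * ℓ′)
  fits = begin
    (3 + n) + (3 + n)    ≡⟨ double n ⟩
    2 + (2 * suc n + 2)  ≤⟨ +-monoʳ-≤ 2 2n+2≤4+ℓ′ ⟩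
    6 + ℓ′               ≤⟨ +-mono-≤ (m≤m+n 6 6) (m≤n*m ℓ′ 3) ⟩
    12 + 3 * ℓ′          ∎
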